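{- For every integer $N$ there exists a numerical semigroup $S$ with $\mathrm{E}(S)<N$; that is, there exist numerical semigroups with arbitrarily large negative Eliahou number.
   Context: A numerical semigroup $S$ is a submonoid of $(\mathbb N,+)$ with finite complement in $\mathbb N$. For a numerical semigroup $S$: the conductor $c$ is the smallest integer such that all integers $\ge c$ lie in $S$; the multiplicity $m$ is the least positive element of $S$; $L=\{s\in S: s<c\}$; $P$ is the set of minimal generators of $S$; $q=\lceil c/m\rceil$; $\rho=qm-c$; $I_q=\{z\in\mathbb Z: c\le z<c+m\}$; $D_q=I_q\setminus P$. The Eliahou number of $S$ is $\mathrm{E}(S)=|P\cap L|\,|L|-q\,|D_q|+\rho$. -}

module Defs where

open import Data.Bool using (Bool; true; false; T; _∧_; not)
open import Data.Nat using (ℕ; zero; suc; _+_; _*_; _∸_; _≤_; _<_; _<ᵇ_; _≡ᵇ_; _/_)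
open import Data.Integer as ℤ using (ℤ; +_)
open import Data.List using (List; []; _∷_; upTo)
open import Data.Bool.ListAction using (any)
open import Data.Product using (Σ; _×_; ∃)
open import Relation.Binary.PropositionalEquality using (_≡_)

record NumericalSemigroup : Set where
  field
    mem      : ℕ → Bool
    zero∈    : T (mem 0)
    closed   : ∀ a b → T (mem a) → T (mem b) → T (mem (a + b))
    cofinite : ∃ λ b → ∀ n → b ≤ n → T (mem n)
open NumericalSemigroup public

_∈S_ : ℕ → NumericalSemigroup → Set
n ∈S S = T (mem S n)

IsConductor : NumericalSemigroup → ℕ → Set
IsConductor S c =
  (∀ n → c ≤ n → n ∈S S) ×
  (∀ d → (∀ n → d ≤ n → n ∈S S) → c ≤ d)

IsMultiplicity : NumericalSemigroup → ℕ → Set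
IsMultiplicity S m =
  (0 < m) × (m ∈S S) × (∀ k → 0 < k → k ∈S S → m ≤ k)

count : (ℕ → Bool) → ℕ → ℕ
count p zero    = zero
count p (suc n) with p n
... | true  = suc (count p n)
... | false = count p n

isMinGen : NumericalSemigroup → ℕ → Bool
isMinGen S s =
  mem S s ∧ (0 <ᵇ s) ∧
  not (any (λ a → (0 <ᵇ a) ∧ mem S a ∧ mem S (s ∸ a)) (upTo s))

-- ⌈ c / m ⌉ (for m > 0; the value at m = 0 is irrelevant)
ceilDiv : ℕ → ℕ → ℕ
ceilDiv c zero    = zero
ceilDiv c (suc k) = (c + k) / suc k

-- Eliahou number E(S) = |P ∩ L| |L| - q |D_q| + ρ, for S with conductor c
-- and multiplicity m, where
--   L = {s ∈ S : s < c},  P = minimal generators,  q = ⌈c/m⌉,  ρ = q m - c,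
--   I_q = [c, c+m),  D_q = I_q \ P.
Eliahou : NumericalSemigroup → (c m : ℕ) → ℤ
Eliahou S c m =
  (+ (PL * Lsz)) ℤ.- (+ (q * Dq)) ℤ.+ (+ ρ)
  where
    Lsz = count (mem S) c
    PL  = count (isMinGen S) c
    q   = ceilDiv c m
    ρ   = q * m ∸ c
    -- |D_q| = m - |P ∩ I_q| (I_q ⊆ S has exactly m elements)
    Dq  = count (λ i → not (isMinGen S (c + i))) m

-- For k : ℕ put K = k + 1, d = K + 4, m = 2 + K d and c = 2K m.  Below c write x = N m + o with
-- o < m (level N, offset o): x ∈ S iff o = 0 or o lies in a block B_t = [m − t d, m − t d + t]
-- with 1 ≤ t ≤ K and 2t ≤ N + 1; everything from c on is in S.  Blocks add like their indices,
-- B_s + B_t ⊆ m + B_{s+t}, and two blocks with s + t > K already sum past c, so S is a numerical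
-- semigroup, with conductor c and multiplicity m.  An element N m + o with o ∈ B_t is m plus an
-- element one level down unless N + 1 = 2t, and then it is a = 2m − d or a + 1 plus an element of
-- B_{t−1} two levels down; so below c the minimal generators are among m, a, a + 1.  Conversely
-- c + o is decomposable for o = 0, for o in a block B_t (t ≥ 2) of the last level and for the last
-- d offsets.  Counting blocks, this set D ⊆ D_q satisfies 6|L| + K k = 4K|D|; as q = 2K and ρ = 0,
-- E(S) ≤ 3|L| − 2K|D_q| ≤ −k.

module Submission where

open import Defs
open import Data.Bool using (Bool; true; false; T; _∧_; _∨_; not; if_then_else_)
open import Data.Bool.ListAction using (any)
open import Data.Bool.Properties using (T-∧; T-∨; T-not-≡; T-≡; if-cong)
open import Data.Empty using (⊥; ⊥-elim)
open import Data.Integer as ℤ using (ℤ; -[1+_]; ∣_∣; _⊖_)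
import Data.Integer.Properties as ℤ
open import Data.List using (upTo)
open import Data.List.Membership.Propositional using (lose)
open import Data.List.Membership.Propositional.Properties using (∈-upTo⁺)
open import Data.List.Relation.Unary.Any.Properties using (any⁺)
open import Data.Nat
  using (ℕ; zero; suc; _+_; _*_; _∸_; _≤_; _<_; z≤n; s≤s; z<s; _≡ᵇ_; _≤ᵇ_; _<ᵇ_; _/_; _%_; NonZero; _≤?_)
open import Data.Nat.Divisibility using (n∣m*n)
open import Data.Nat.DivMod
open import Data.Nat.Properties
open import Algebra.Properties.CommutativeSemigroup +-commutativeSemigroup
  using (interchange; xy∙z≈xz∙y; xy∙z≈x∙zy; x∙yz≈yx∙z)
open import Data.Nat.Tactic.RingSolver using (solve-∀)
open import Data.Product using (_×_; ∃; _,_; proj₁; proj₂)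
open import Data.Sum using (_⊎_; inj₁; inj₂; [_,_]′) renaming (map to ⊎-map)
open import Function using (_∘_)
open import Function.Bundles using (Equivalence)
open import Relation.Nullary using (¬_; Dec; yes; no; contradiction)
open import Relation.Binary.PropositionalEquality

private
  variable
    p r : ℕ → Bool

count-+ : ∀ p a b → count p (a + b) ≡ count p a + count (λ i → p (a + i)) b
count-+ p a zero rewrite +-identityʳ a = sym (+-identityʳ _)
count-+ p a (suc b) rewrite +-suc a b with p (a + b) | count-+ p a b
... | true  | ih = trans (cong suc ih) (sym (+-suc _ _))
... | false | ih = ih

Below : (ℕ → Set) → ℕ → Set
Below P n = ∀ i → i < n → P i

below-pred : ∀ {P n} → Below P (suc n) → Below P n
below-pred h i i<n = h i (m≤n⇒m≤1+n i<n)

count-cong : ∀ n → Below (λ i → p i ≡ r i) n → count p n ≡ count r n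
count-cong zero    h = refl
count-cong {p} {r} (suc n) h with p n | r n | h n ≤-refl | count-cong n (below-pred h)
... | true  | true  | _ | ih = cong suc ih
... | false | false | _ | ih = ih

count-mono : ∀ n → Below (λ i → T (p i) → T (r i)) n → count p n ≤ count r n
count-mono zero    h = z≤n
count-mono {p} {r} (suc n) h with p n | r n | h n ≤-refl | count-mono n (below-pred h)
... | true  | true  | _  | ih = s≤s ih
... | true  | false | pr | ih = ⊥-elim (pr _)
... | false | true  | _  | ih = m≤n⇒m≤1+n ih
... | false | false | _  | ih = ih

count-none : ∀ n → Below (λ i → ¬ T (p i)) n → count p n ≡ 0
count-none zero    h = refl
count-none {p} (suc n) h with p n | h n ≤-refl
... | true  | ¬pn = contradiction _ ¬pn
... | false | _   = count-none n (below-pred h)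

count-all : ∀ n → Below (T ∘ p) n → count p n ≡ n
count-all zero    h = refl
count-all {p} (suc n) h with p n | h n ≤-refl
... | true | _ = cong suc (count-all n (below-pred h))

count-∨ : ∀ n → Below (λ i → T (p i) → ¬ T (r i)) n →
          count (λ i → p i ∨ r i) n ≡ count p n + count r n
count-∨ zero    h = refl
count-∨ {p} {r} (suc n) h with p n | r n | h n ≤-refl | count-∨ n (below-pred h)
... | true  | true  | disj | ih = contradiction _ (disj _)
... | true  | false | _    | ih = cong suc ih
... | false | true  | _    | ih = trans (cong suc ih) (sym (+-suc _ _))
... | false | false | _    | ih = ih

count-∨-≤ : ∀ n → count (λ i → p i ∨ r i) n ≤ count p n + count r n
count-∨-≤ zero = z≤n
count-∨-≤ {p} {r} (suc n) with p n | r n | count-∨-≤ {p} {r} n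
... | true  | true  | ih = s≤s (≤-trans ih (+-monoʳ-≤ (count p n) (n≤1+n _)))
... | true  | false | ih = s≤s ih
... | false | true  | ih = ≤-trans (s≤s ih) (≤-reflexive (sym (+-suc _ _)))
... | false | false | ih = ih

count-≡ᵇ-≤ : ∀ v n → count (_≡ᵇ v) n ≤ 1
count-≡ᵇ-≤ v zero = z≤n
count-≡ᵇ-≤ v (suc n) with n ≡ᵇ v in eq
... | false = count-≡ᵇ-≤ v n
... | true  = ≤-reflexive (cong suc (count-none n λ i i<n i≡v →
                <-irrefl (trans (≡ᵇ⇒≡ i v i≡v) (sym (≡ᵇ⇒≡ n v (subst T (sym eq) _)))) i<n))

count-interval : ∀ l w n → l + w ≤ n →
                 Below (λ i → T (p i) → l ≤ i × i < l + w) n →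
                 (∀ i → l ≤ i → i < l + w → T (p i)) →
                 count p n ≡ w
count-interval {p} l w n l+w≤n inside⇒ ⇒inside = begin
  count p n                                             ≡⟨ cong (count p) n≡ ⟩
  count p (l + (w + e))                                 ≡⟨ count-+ p l (w + e) ⟩
  count p l + count (λ i → p (l + i)) (w + e)           ≡⟨ cong₂ _+_ before (count-+ _ w e) ⟩
  0 + (count (λ i → p (l + i)) w + count (λ i → p (l + (w + i))) e)
                                                        ≡⟨ cong₂ _+_ inside after ⟩
  w + 0                                                 ≡⟨ +-identityʳ w ⟩
  w                                                     ∎
  where
  open ≡-Reasoning
  e = n ∸ (l + w)
  n≡ : n ≡ l + (w + e)
  n≡ = trans (sym (m+[n∸m]≡n l+w≤n)) (+-assoc l w e)
  before : count p l ≡ 0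
  before = count-none l λ i i<l pi →
    <-irrefl refl (<-≤-trans i<l (proj₁ (inside⇒ i (<-≤-trans i<l (≤-trans (m≤m+n l w) l+w≤n)) pi)))
  inside : count (λ i → p (l + i)) w ≡ w
  inside = count-all w λ i i<w → ⇒inside (l + i) (m≤m+n l i) (+-monoʳ-< l i<w)
  after : count (λ i → p (l + (w + i))) e ≡ 0
  after = count-none e λ i i<e pi → <-irrefl refl (<-≤-trans
    (proj₂ (inside⇒ (l + (w + i)) (subst (l + (w + i) <_) (sym n≡) (+-monoʳ-< l (+-monoʳ-< w i<e))) pi))
    (+-monoʳ-≤ l (m≤m+n w i)))

count-if : ∀ b p n → count (λ i → b ∧ p i) n ≡ (if b then count p n else 0)
count-if true  p n = refl
count-if false p n = count-none n λ _ _ ()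

count-window : ∀ M D t n → D ≤ M → M + t < n + D →
               count (λ i → (M ≤ᵇ i + D) ∧ (i + D ≤ᵇ M + t)) n ≡ suc t
count-window M D t n D≤M fits = count-interval l (suc t) n l+w≤n inside⇒ ⇒inside
  where
  open ≤-Reasoning
  l = M ∸ D
  l+D≡M : l + D ≡ M
  l+D≡M = m∸n+n≡m D≤M
  l+t+D≡M+t : l + t + D ≡ M + t
  l+t+D≡M+t = trans (xy∙z≈xz∙y l t D) (cong (_+ t) l+D≡M)
  l+w≤n : l + suc t ≤ n
  l+w≤n = +-cancelʳ-≤ D _ n (begin
    l + suc t + D  ≡⟨ xy∙z≈xz∙y l (suc t) D ⟩
    l + D + suc t  ≡⟨ cong (_+ suc t) l+D≡M ⟩
    M + suc t      ≡⟨ +-suc M t ⟩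
    suc (M + t)    ≤⟨ fits ⟩
    n + D          ∎)
  inside⇒ : Below (λ i → T ((M ≤ᵇ i + D) ∧ (i + D ≤ᵇ M + t)) → l ≤ i × i < l + suc t) n
  inside⇒ i _ h with Equivalence.to (T-∧ {M ≤ᵇ i + D}) h
  ... | start , end =
    +-cancelʳ-≤ D l i (subst (_≤ i + D) (sym l+D≡M) (≤ᵇ⇒≤ M _ start)) ,
    ≤-<-trans (+-cancelʳ-≤ D i (l + t) (subst (i + D ≤_) (sym l+t+D≡M+t) (≤ᵇ⇒≤ _ _ end)))
              (+-monoʳ-< l (n<1+n t))
  ⇒inside : ∀ i → l ≤ i → i < l + suc t → T ((M ≤ᵇ i + D) ∧ (i + D ≤ᵇ M + t))
  ⇒inside i l≤i i<l+1+t = Equivalence.from (T-∧ {M ≤ᵇ i + D})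
    ( ≤⇒≤ᵇ (subst (_≤ i + D) l+D≡M (+-monoˡ-≤ D l≤i))
    , ≤⇒≤ᵇ (subst (i + D ≤_) l+t+D≡M+t (+-monoˡ-≤ D (≤-pred (subst (suc i ≤_) (+-suc l t) i<l+1+t)))))

count-≡ᵇ : ∀ v n → v < n → count (_≡ᵇ v) n ≡ 1
count-≡ᵇ v n v<n = count-interval v 1 n (subst (_≤ n) (+-comm 1 v) v<n)
  (λ i _ i≡v → ≤-reflexive (sym (≡ᵇ⇒≡ i v i≡v))
              , ≤-reflexive (trans (cong suc (≡ᵇ⇒≡ i v i≡v)) (+-comm 1 v)))
  (λ i v≤i i<v+1 → ≡⇒≡ᵇ i v (≤-antisym (≤-pred (subst (suc i ≤_) (+-comm v 1) i<v+1)) v≤i))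

sumBelow : (ℕ → ℕ) → ℕ → ℕ
sumBelow f zero    = 0
sumBelow f (suc n) = sumBelow f n + f n

sumBelow-0 : ∀ n → sumBelow (λ _ → 0) n ≡ 0
sumBelow-0 zero    = refl
sumBelow-0 (suc n) = trans (+-identityʳ _) (sumBelow-0 n)

sumBelow-+ : ∀ f g n → sumBelow (λ i → f i + g i) n ≡ sumBelow f n + sumBelow g n
sumBelow-+ f g zero    = refl
sumBelow-+ f g (suc n) =
  trans (cong (_+ (f n + g n)) (sumBelow-+ f g n)) (interchange (sumBelow f n) (sumBelow g n) (f n) (g n))

sumBelow-suc : ∀ f n → sumBelow (λ i → suc (f i)) n ≡ n + sumBelow f n
sumBelow-suc f n = trans (sumBelow-+ (λ _ → 1) f n) (cong (_+ sumBelow f n) (ones n))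
  where
  ones : ∀ n → sumBelow (λ _ → 1) n ≡ n
  ones zero    = refl
  ones (suc n) = trans (cong (_+ 1) (ones n)) (+-comm n 1)

sumBelow-if : ∀ p w n → sumBelow (λ i → if p i then w else 0) n ≡ w * count p n
sumBelow-if p w zero    = sym (*-zeroʳ w)
sumBelow-if p w (suc n) with p n
... | true  = trans (cong (_+ w) (sumBelow-if p w n))
                    (trans (+-comm _ w) (sym (*-suc w (count p n))))
... | false = trans (+-identityʳ _) (sumBelow-if p w n)

T-not⇒¬T : ∀ {b} → T (not b) → ¬ T b
T-not⇒¬T {false} _ ()

¬T⇒T-not : ∀ {b} → ¬ T b → T (not b)
¬T⇒T-not {false} _  = _
¬T⇒T-not {true}  ¬t = ¬t _

record Decomposition (S : NumericalSemigroup) (x : ℕ) : Set where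
  constructor decomposition
  field
    left right : ℕ
    left>0     : 0 < left
    right>0    : 0 < right
    x≡         : x ≡ left + right
    left∈S     : left ∈S S
    right∈S    : right ∈S S

Decomposition-cong : ∀ {S x y} → x ≡ y → Decomposition S y → Decomposition S x
Decomposition-cong refl D = D

module _ (S : NumericalSemigroup) {x : ℕ} where

  private
    splits : ℕ → Bool
    splits a = (0 <ᵇ a) ∧ mem S a ∧ mem S (x ∸ a)

    positive×unsplittable : T (isMinGen S x) → T (0 <ᵇ x) × T (not (any splits (upTo x)))
    positive×unsplittable x-gen =
      Equivalence.to (T-∧ {0 <ᵇ x}) (proj₂ (Equivalence.to (T-∧ {mem S x}) x-gen))

  isMinGen⇒∈ : T (isMinGen S x) → x ∈S S
  isMinGen⇒∈ x-gen = proj₁ (Equivalence.to (T-∧ {mem S x}) x-gen)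

  isMinGen⇒>0 : T (isMinGen S x) → 0 < x
  isMinGen⇒>0 x-gen = <ᵇ⇒< 0 x (proj₁ (positive×unsplittable x-gen))

  Decomposition⇒¬isMinGen : Decomposition S x → ¬ T (isMinGen S x)
  Decomposition⇒¬isMinGen (decomposition w r 0<w 0<r x≡w+r w∈S r∈S) x-gen =
    T-not⇒¬T (proj₂ (positive×unsplittable x-gen)) (any⁺ splits (lose (∈-upTo⁺ w<x) w-splits))
    where
    w<x : w < x
    w<x = subst (w <_) (sym x≡w+r) (m<m+n w 0<r)
    x∸w∈S : (x ∸ w) ∈S S
    x∸w∈S = subst (_∈S S) (sym (trans (cong (_∸ w) x≡w+r) (m+n∸m≡n w r))) r∈S
    w-splits : T (splits w)
    w-splits = Equivalence.from (T-∧ {0 <ᵇ w}) (<⇒<ᵇ 0<w , Equivalence.from (T-∧ {mem S w}) (w∈S , x∸w∈S))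

+m-+n≤-+o : ∀ m n o → m + o ≤ n → ℤ.+ m ℤ.- ℤ.+ n ℤ.≤ ℤ.- ℤ.+ o
+m-+n≤-+o m n o m+o≤n = begin
  ℤ.+ m ℤ.- ℤ.+ n          ≤⟨ ℤ.+-monoʳ-≤ (ℤ.+ m) (ℤ.neg-mono-≤ (ℤ.+≤+ m+o≤n)) ⟩
  ℤ.+ m ℤ.- ℤ.+ (m + o)    ≡⟨ ℤ.[+m]-[+n]≡m⊖n m (m + o) ⟩
  m ⊖ (m + o)              ≡⟨ cong (_⊖ (m + o)) (+-identityʳ m) ⟨
  (m + 0) ⊖ (m + o)        ≡⟨ ℤ.+-cancelˡ-⊖ m 0 o ⟩
  0 ⊖ o                    ≡⟨ ℤ.⊖-≤ z≤n ⟩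
  ℤ.- ℤ.+ o                ∎
  where open ℤ.≤-Reasoning

-1-∣i∣<i : ∀ i → ℤ.- ℤ.+ suc ∣ i ∣ ℤ.< i
-1-∣i∣<i (ℤ.+ _)  = ℤ.-<+
-1-∣i∣<i -[1+ n ] = ℤ.-<- ≤-refl

-- the inductive step of 6h + 4n³ + 9n² = 3n(n+3)M + n for h = Σ_{t=1}^{n} (t+1)(M − 2t + 1),
-- where w = M − 2n − 1
block-sum-step : ∀ h w n →
  6 * h + 4 * (n * n * n) + 9 * (n * n) ≡ 3 * n * (n + 3) * (w + suc (2 * n)) + n →
  6 * (h + suc (suc n) * w) + 4 * (suc n * suc n * suc n) + 9 * (suc n * suc n)
    ≡ 3 * suc n * (suc n + 3) * (w + suc (2 * n)) + suc n
block-sum-step h w n ih = begin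
  6 * (h + suc (suc n) * w) + 4 * (suc n * suc n * suc n) + 9 * (suc n * suc n)
    ≡⟨ expand h w n ⟩
  (6 * h + 4 * (n * n * n) + 9 * (n * n)) + Δ
    ≡⟨ cong (_+ Δ) ih ⟩
  (3 * n * (n + 3) * (w + suc (2 * n)) + n) + Δ
    ≡⟨ collect w n ⟩
  3 * suc n * (suc n + 3) * (w + suc (2 * n)) + suc n
    ∎
  where
  open ≡-Reasoning
  Δ = 6 * (n + 2) * w + 12 * (n * n) + 30 * n + 13
  expand : ∀ h w n → 6 * (h + suc (suc n) * w) + 4 * (suc n * suc n * suc n) + 9 * (suc n * suc n)
                   ≡ (6 * h + 4 * (n * n * n) + 9 * (n * n)) + (6 * (n + 2) * w + 12 * (n * n) + 30 * n + 13)
  expand = solve-∀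
  collect : ∀ w n → (3 * n * (n + 3) * (w + suc (2 * n)) + n) + (6 * (n + 2) * w + 12 * (n * n) + 30 * n + 13)
                  ≡ 3 * suc n * (suc n + 3) * (w + suc (2 * n)) + suc n
  collect = solve-∀

-- 6|L| + K k = 4K|D| for K = k + 1, |L| = 2K + h and |D| = 1 + b + (5 + k)
eliahou-identity : ∀ k h b →
  6 * h + 4 * (suc k * suc k * suc k) + 9 * (suc k * suc k) ≡ 3 * suc k * (suc k + 3) * (2 * suc k) + suc k →
  2 * b ≡ k * (k + 5) →
  6 * (2 * suc k + h) + suc k * k ≡ 4 * suc k * (1 + b + (5 + k))
eliahou-identity k h b 6h≡ 2b≡ = +-cancelʳ-≡ (4 * (K * K * K) + 9 * (K * K)) _ _ (begin
  6 * (2 * K + h) + K * k + (4 * (K * K * K) + 9 * (K * K))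
    ≡⟨ isolate-h k h ⟩
  (12 * K + K * k) + (6 * h + 4 * (K * K * K) + 9 * (K * K))
    ≡⟨ cong ((12 * K + K * k) +_) 6h≡ ⟩
  (12 * K + K * k) + (3 * K * (K + 3) * (2 * K) + K)
    ≡⟨ polynomial k ⟩
  4 * K * (1 + (5 + k)) + 2 * K * (k * (k + 5)) + (4 * (K * K * K) + 9 * (K * K))
    ≡⟨ cong (λ z → 4 * K * (1 + (5 + k)) + 2 * K * z + (4 * (K * K * K) + 9 * (K * K))) 2b≡ ⟨
  4 * K * (1 + (5 + k)) + 2 * K * (2 * b) + (4 * (K * K * K) + 9 * (K * K))
    ≡⟨ isolate-b k b ⟩
  4 * K * (1 + b + (5 + k)) + (4 * (K * K * K) + 9 * (K * K))
    ∎)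
  where
  open ≡-Reasoning
  K = suc k
  isolate-h : ∀ k h → 6 * (2 * suc k + h) + suc k * k + (4 * (suc k * suc k * suc k) + 9 * (suc k * suc k))
                    ≡ (12 * suc k + suc k * k) + (6 * h + 4 * (suc k * suc k * suc k) + 9 * (suc k * suc k))
  isolate-h = solve-∀
  polynomial : ∀ k → (12 * suc k + suc k * k) + (3 * suc k * (suc k + 3) * (2 * suc k) + suc k)
                   ≡ 4 * suc k * (1 + (5 + k)) + 2 * suc k * (k * (k + 5))
                     + (4 * (suc k * suc k * suc k) + 9 * (suc k * suc k))
  polynomial = solve-∀
  isolate-b : ∀ k b → 4 * suc k * (1 + (5 + k)) + 2 * suc k * (2 * b)
                      + (4 * (suc k * suc k * suc k) + 9 * (suc k * suc k))
                    ≡ 4 * suc k * (1 + b + (5 + k)) + (4 * (suc k * suc k * suc k) + 9 * (suc k * suc k))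
  isolate-b = solve-∀

2*[1+n]≡2+2*n : ∀ n → 2 * suc n ≡ suc (suc (2 * n))
2*[1+n]≡2+2*n n = cong suc (+-suc n (n + 0))

2*n≤[1+n]*n : ∀ n → 2 * n ≤ suc n * n
2*n≤[1+n]*n zero    = z≤n
2*n≤[1+n]*n (suc n) = *-monoˡ-≤ (suc n) {2} {suc (suc n)} (s≤s (s≤s z≤n))

module Construction (k : ℕ) where

  K d m c a : ℕ
  K = suc k
  d = 5 + k
  m = 2 + K * d
  c = 2 * K * m
  a = m + (2 + k * d)

  instance
    m-nonZero : NonZero m
    m-nonZero = _

  inBlock : ℕ → ℕ → Bool
  inBlock t o = (m ≤ᵇ o + t * d) ∧ (o + t * d ≤ᵇ m + t)

  hasBlock : ℕ → ℕ → Bool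
  hasBlock N t = 2 * t ≤ᵇ suc N

  inBlocks : (s n N o : ℕ) → Bool
  inBlocks s zero    N o = false
  inBlocks s (suc n) N o = inBlocks s n N o ∨ (hasBlock N (s + suc n) ∧ inBlock (s + suc n) o)

  atLevel : ℕ → ℕ → Bool
  atLevel N o = (o ≡ᵇ 0) ∨ inBlocks 0 K N o

  memS : ℕ → Bool
  memS x = (c ≤ᵇ x) ∨ atLevel (x / m) (x % m)

  record InBlock (t o : ℕ) : Set where
    constructor block
    field
      pos    : ℕ
      pos≤t  : pos ≤ t
      offset : o + t * d ≡ m + pos

  record InBlocks (s n N o t : ℕ) : Set where
    constructor blocks
    field
      s<t      : s < t
      t≤s+n    : t ≤ s + n
      2t≤1+N   : 2 * t ≤ suc N
      ∈block   : InBlock t o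

  inBlock⁺ : ∀ {t o} → InBlock t o → T (inBlock t o)
  inBlock⁺ {t} {o} (block j j≤t eq) = Equivalence.from (T-∧ {m ≤ᵇ o + t * d})
    ( ≤⇒≤ᵇ (subst (m ≤_) (sym eq) (m≤m+n m j))
    , ≤⇒≤ᵇ (subst (_≤ m + t) (sym eq) (+-monoʳ-≤ m j≤t)))

  inBlock⁻ : ∀ t o → T (inBlock t o) → InBlock t o
  inBlock⁻ t o h with Equivalence.to (T-∧ {m ≤ᵇ o + t * d}) h
  ... | start , end with m≤n⇒∃[o]m+o≡n (≤ᵇ⇒≤ m _ start)
  ...   | j , eq = block j (+-cancelˡ-≤ m j t (subst (_≤ m + t) (sym eq) (≤ᵇ⇒≤ _ _ end))) (sym eq)

  inBlocks⁺ : ∀ s n N o t → InBlocks s n N o t → T (inBlocks s n N o)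
  inBlocks⁺ s zero    N o t (blocks s<t t≤s+0 _ _) =
    contradiction (subst (t ≤_) (+-identityʳ s) t≤s+0) (<⇒≱ s<t)
  inBlocks⁺ s (suc n) N o t (blocks s<t t≤s+n+1 2t≤N+1 t∋o) with m≤n⇒m<n∨m≡n t≤s+n+1
  ... | inj₁ t<s+n+1 = Equivalence.from T-∨ (inj₁ (inBlocks⁺ s n N o t
          (blocks s<t (≤-pred (subst (t <_) (+-suc s n) t<s+n+1)) 2t≤N+1 t∋o)))
  ... | inj₂ refl    = Equivalence.from (T-∨ {inBlocks s n N o}) (inj₂
          (Equivalence.from (T-∧ {hasBlock N t}) (≤⇒≤ᵇ 2t≤N+1 , inBlock⁺ t∋o)))

  inBlocks⁻ : ∀ s n N o → T (inBlocks s n N o) → ∃ (InBlocks s n N o)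
  inBlocks⁻ s (suc n) N o h with Equivalence.to (T-∨ {inBlocks s n N o}) h
  ... | inj₁ h′ = let t , blocks s<t t≤s+n 2t≤N+1 t∋o = inBlocks⁻ s n N o h′ in
                  t , blocks s<t (≤-trans t≤s+n (+-monoʳ-≤ s (n≤1+n n))) 2t≤N+1 t∋o
  ... | inj₂ h′ with Equivalence.to (T-∧ {hasBlock N (s + suc n)}) h′
  ...   | 2t≤N+1 , t∋o = s + suc n ,
          blocks (m<m+n s z<s) ≤-refl (≤ᵇ⇒≤ _ _ 2t≤N+1) (inBlock⁻ (s + suc n) o t∋o)

  t*d+2≤m : ∀ {t} → t ≤ K → t * d + 2 ≤ m
  t*d+2≤m {t} t≤K = subst (_≤ m) (+-comm 2 (t * d)) (+-monoʳ-≤ 2 (*-monoˡ-≤ d t≤K))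

  2+t≤t*d : ∀ {t} → 1 ≤ t → 2 + t ≤ t * d
  2+t≤t*d {suc t} _ = begin
    3 + t         ≤⟨ +-monoʳ-≤ 3 (m≤m*n t 3) ⟩
    suc t * 3     ≤⟨ *-monoʳ-≤ (suc t) (s≤s (s≤s (s≤s z≤n))) ⟩
    suc t * d     ∎
    where open ≤-Reasoning

  InBlock⇒2+o≤m : ∀ {t o} → 1 ≤ t → InBlock t o → 2 + o ≤ m
  InBlock⇒2+o≤m {t} {o} 1≤t (block j j≤t eq) = +-cancelʳ-≤ t (2 + o) m (begin
    2 + o + t     ≡⟨ cong (_+ t) (+-comm 2 o) ⟩
    o + 2 + t     ≡⟨ +-assoc o 2 t ⟩
    o + (2 + t)   ≤⟨ +-monoʳ-≤ o (2+t≤t*d 1≤t) ⟩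
    o + t * d     ≡⟨ eq ⟩
    m + j         ≤⟨ +-monoʳ-≤ m j≤t ⟩
    m + t         ∎)
    where open ≤-Reasoning

  InBlock⇒<m : ∀ {t o} → 1 ≤ t → InBlock t o → o < m
  InBlock⇒<m 1≤t b = ≤-trans (s≤s (n≤1+n _)) (InBlock⇒2+o≤m 1≤t b)

  InBlock⇒>0 : ∀ {t o} → t ≤ K → InBlock t o → 0 < o
  InBlock⇒>0 {t} {zero} t≤K (block j _ eq) = contradiction
    (≤-trans (t*d+2≤m t≤K) (subst (m ≤_) (sym eq) (m≤m+n m j)))
    (<⇒≱ (m<m+n (t * d) z<s))
  InBlock⇒>0 {o = suc o} _ _ = z<s

  /-level : ∀ N {o} → o < m → (N * m + o) / m ≡ N
  /-level N {o} o<m = begin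
    (N * m + o) / m     ≡⟨ +-distrib-/-∣ˡ o (n∣m*n N) ⟩
    N * m / m + o / m   ≡⟨ cong₂ _+_ (m*n/n≡m N m) (m<n⇒m/n≡0 o<m) ⟩
    N + 0               ≡⟨ +-identityʳ N ⟩
    N                   ∎
    where open ≡-Reasoning

  %-level : ∀ N {o} → o < m → (N * m + o) % m ≡ o
  %-level N {o} o<m = trans (cong (_% m) (+-comm (N * m) o))
                            (trans ([m+kn]%n≡m%n o N m) (m<n⇒m%n≡m o<m))

  level-split : ∀ x → x ≡ x / m * m + x % m
  level-split x = trans (m≡m%n+[m/n]*n x m) (+-comm (x % m) _)

  memS-level : ∀ N {o} → o < m → memS (N * m + o) ≡ (c ≤ᵇ N * m + o) ∨ atLevel N o
  memS-level N o<m rewrite /-level N o<m | %-level N o<m = refl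

  atLevel⇒∈ : ∀ N {o} → o < m → T (atLevel N o) → T (memS (N * m + o))
  atLevel⇒∈ N {o} o<m h rewrite memS-level N o<m = Equivalence.from (T-∨ {c ≤ᵇ N * m + o}) (inj₂ h)

  ∈⇒atLevel : ∀ N {o} → o < m → N * m + o < c → T (memS (N * m + o)) → T (atLevel N o)
  ∈⇒atLevel N {o} o<m x<c h rewrite memS-level N o<m with Equivalence.to (T-∨ {c ≤ᵇ N * m + o}) h
  ... | inj₁ c≤x = contradiction (≤ᵇ⇒≤ c _ c≤x) (<⇒≱ x<c)
  ... | inj₂ h′  = h′

  ≥c⇒∈ : ∀ {x} → c ≤ x → T (memS x)
  ≥c⇒∈ c≤x = Equivalence.from T-∨ (inj₁ (≤⇒≤ᵇ c≤x))

  atLevel⁺ : ∀ N o t → InBlocks 0 K N o t → T (atLevel N o)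
  atLevel⁺ N o t b = Equivalence.from (T-∨ {o ≡ᵇ 0}) (inj₂ (inBlocks⁺ 0 K N o t b))

  atLevel⁻ : ∀ N o → T (atLevel N o) → o ≡ 0 ⊎ ∃ (InBlocks 0 K N o)
  atLevel⁻ N o h with Equivalence.to (T-∨ {o ≡ᵇ 0}) h
  ... | inj₁ o≡0 = inj₁ (≡ᵇ⇒≡ o 0 o≡0)
  ... | inj₂ h′  = inj₂ (inBlocks⁻ 0 K N o h′)

  level∈ : ∀ N → T (memS (N * m + 0))
  level∈ N = atLevel⇒∈ N z<s _

  block∈ : ∀ N o t → InBlocks 0 K N o t → T (memS (N * m + o))
  block∈ N o t b = atLevel⇒∈ N (InBlock⇒<m (InBlocks.s<t b) (InBlocks.∈block b)) (atLevel⁺ N o t b)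

  atLevel-mono : ∀ {N N′} o → N ≤ N′ → T (atLevel N o) → T (atLevel N′ o)
  atLevel-mono {N} {N′} o N≤N′ h with atLevel⁻ N o h
  ... | inj₁ refl = _
  ... | inj₂ (t , blocks 0<t t≤K 2t≤1+N t∋o) =
    atLevel⁺ N′ o t (blocks 0<t t≤K (≤-trans 2t≤1+N (s≤s N≤N′)) t∋o)

  block-+ : ∀ {t₁ t₂ o₁ o₂} → t₁ + t₂ ≤ K → InBlock t₁ o₁ → InBlock t₂ o₂ →
            ∃ λ o → o₁ + o₂ ≡ m + o × InBlock (t₁ + t₂) o
  block-+ {t₁} {t₂} {o₁} {o₂} t₁+t₂≤K (block j₁ j₁≤t₁ eq₁) (block j₂ j₂≤t₂ eq₂) =
    o₁ + o₂ ∸ m , sym (m+[n∸m]≡n m≤o₁+o₂) , block (j₁ + j₂) (+-mono-≤ j₁≤t₁ j₂≤t₂) offset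
    where
    open ≤-Reasoning
    D = (t₁ + t₂) * d
    sum : (o₁ + o₂) + D ≡ m + (m + (j₁ + j₂))
    sum = begin-equality
      (o₁ + o₂) + D                  ≡⟨ cong ((o₁ + o₂) +_) (*-distribʳ-+ d t₁ t₂) ⟩
      (o₁ + o₂) + (t₁ * d + t₂ * d)  ≡⟨ interchange o₁ o₂ (t₁ * d) (t₂ * d) ⟩
      (o₁ + t₁ * d) + (o₂ + t₂ * d)  ≡⟨ cong₂ _+_ eq₁ eq₂ ⟩
      (m + j₁) + (m + j₂)            ≡⟨ interchange m j₁ m j₂ ⟩
      (m + m) + (j₁ + j₂)            ≡⟨ +-assoc m m (j₁ + j₂) ⟩
      m + (m + (j₁ + j₂))            ∎
    m≤o₁+o₂ : m ≤ o₁ + o₂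
    m≤o₁+o₂ = +-cancelʳ-≤ D m (o₁ + o₂) (begin
      m + D                  ≤⟨ +-monoʳ-≤ m (≤-trans (m≤m+n D 2) (t*d+2≤m t₁+t₂≤K)) ⟩
      m + m                  ≤⟨ +-monoʳ-≤ m (m≤m+n m (j₁ + j₂)) ⟩
      m + (m + (j₁ + j₂))    ≡⟨ sum ⟨
      (o₁ + o₂) + D          ∎)
    offset : (o₁ + o₂ ∸ m) + D ≡ m + (j₁ + j₂)
    offset = +-cancelˡ-≡ m _ _ (begin-equality
      m + ((o₁ + o₂ ∸ m) + D)  ≡⟨ +-assoc m _ D ⟨
      m + (o₁ + o₂ ∸ m) + D    ≡⟨ cong (_+ D) (m+[n∸m]≡n m≤o₁+o₂) ⟩
      (o₁ + o₂) + D            ≡⟨ sum ⟩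
      m + (m + (j₁ + j₂))      ∎)

  blocks-+-≥c : ∀ {N₁ N₂ o₁ o₂ t₁ t₂} → InBlocks 0 K N₁ o₁ t₁ → InBlocks 0 K N₂ o₂ t₂ →
                K < t₁ + t₂ → c ≤ (N₁ * m + o₁) + (N₂ * m + o₂)
  blocks-+-≥c {N₁} {N₂} {o₁} {o₂} {t₁} {t₂} b₁ b₂ K<t₁+t₂ = +-cancelʳ-≤ (m + m) c _ (begin
    c + (m + m)                       ≡⟨ double-suc K m ⟩
    2 * suc K * m                     ≤⟨ *-monoˡ-≤ m (*-monoʳ-≤ 2 K<t₁+t₂) ⟩
    2 * (t₁ + t₂) * m                 ≡⟨ double-+ t₁ t₂ m ⟩
    2 * t₁ * m + 2 * t₂ * m           ≤⟨ +-mono-≤ (lower b₁) (lower b₂) ⟩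
    (X + t₁ * d) + (Y + t₂ * d)       ≡⟨ interchange X (t₁ * d) Y (t₂ * d) ⟩
    (X + Y) + (t₁ * d + t₂ * d)       ≤⟨ +-monoʳ-≤ (X + Y) (+-mono-≤ (t*d≤m b₁) (t*d≤m b₂)) ⟩
    (X + Y) + (m + m)                 ∎)
    where
    open ≤-Reasoning
    X = N₁ * m + o₁
    Y = N₂ * m + o₂
    double-suc : ∀ K m → 2 * K * m + (m + m) ≡ 2 * suc K * m
    double-suc = solve-∀
    double-+ : ∀ t₁ t₂ m → 2 * (t₁ + t₂) * m ≡ 2 * t₁ * m + 2 * t₂ * m
    double-+ = solve-∀
    t*d≤m : ∀ {N o t} → InBlocks 0 K N o t → t * d ≤ m
    t*d≤m b = ≤-trans (m≤m+n _ 2) (t*d+2≤m (InBlocks.t≤s+n b))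
    lower : ∀ {N o t} → InBlocks 0 K N o t → 2 * t * m ≤ (N * m + o) + t * d
    lower {N} {o} {t} (blocks _ _ 2t≤1+N (block j _ eq)) = begin
      2 * t * m              ≤⟨ *-monoˡ-≤ m 2t≤1+N ⟩
      suc N * m              ≡⟨ +-comm m (N * m) ⟩
      N * m + m              ≤⟨ +-monoʳ-≤ (N * m) (m≤m+n m j) ⟩
      N * m + (m + j)        ≡⟨ cong (N * m +_) eq ⟨
      N * m + (o + t * d)    ≡⟨ +-assoc (N * m) o (t * d) ⟨
      (N * m + o) + t * d    ∎

  blocks-+∈S : ∀ {N₁ N₂ o₁ o₂ t₁ t₂} → InBlocks 0 K N₁ o₁ t₁ → InBlocks 0 K N₂ o₂ t₂ → t₁ + t₂ ≤ K →
               T (memS ((N₁ * m + o₁) + (N₂ * m + o₂)))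
  blocks-+∈S {N₁} {N₂} {o₁} {o₂} {t₁} {t₂} b₁ b₂ t₁+t₂≤K
    with block-+ t₁+t₂≤K (InBlocks.∈block b₁) (InBlocks.∈block b₂)
  ... | o , o₁+o₂≡m+o , t₁+t₂∋o = subst (T ∘ memS) (sym carry)
    (block∈ (suc (N₁ + N₂)) o (t₁ + t₂)
      (blocks (<-≤-trans (InBlocks.s<t b₁) (m≤m+n t₁ t₂)) t₁+t₂≤K has-block t₁+t₂∋o))
    where
    has-block : 2 * (t₁ + t₂) ≤ suc (suc (N₁ + N₂))
    has-block = begin
      2 * (t₁ + t₂)        ≡⟨ *-distribˡ-+ 2 t₁ t₂ ⟩
      2 * t₁ + 2 * t₂      ≤⟨ +-mono-≤ (InBlocks.2t≤1+N b₁) (InBlocks.2t≤1+N b₂) ⟩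
      suc N₁ + suc N₂      ≡⟨ cong suc (+-suc N₁ N₂) ⟩
      suc (suc (N₁ + N₂))  ∎
      where open ≤-Reasoning
    carry : (N₁ * m + o₁) + (N₂ * m + o₂) ≡ suc (N₁ + N₂) * m + o
    carry = begin
      (N₁ * m + o₁) + (N₂ * m + o₂)  ≡⟨ interchange (N₁ * m) o₁ (N₂ * m) o₂ ⟩
      (N₁ * m + N₂ * m) + (o₁ + o₂)  ≡⟨ cong (N₁ * m + N₂ * m +_) o₁+o₂≡m+o ⟩
      (N₁ * m + N₂ * m) + (m + o)    ≡⟨ regroup N₁ N₂ m o ⟩
      suc (N₁ + N₂) * m + o          ∎
      where
      open ≡-Reasoning
      regroup : ∀ N₁ N₂ m o → (N₁ * m + N₂ * m) + (m + o) ≡ suc (N₁ + N₂) * m + o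
      regroup = solve-∀

  levels-+ : ∀ N₁ N₂ {o₁ o₂} → o₁ < m → o₂ < m → (N₁ * m + o₁) + (N₂ * m + o₂) < c →
             T (atLevel N₁ o₁) → T (atLevel N₂ o₂) → T (memS ((N₁ * m + o₁) + (N₂ * m + o₂)))
  levels-+ N₁ N₂ {o₁} {o₂} o₁<m o₂<m sum<c h₁ h₂ = cases (atLevel⁻ N₁ o₁ h₁) (atLevel⁻ N₂ o₂ h₂)
    where
    shift : ∀ N₁ N₂ m o → N₁ * m + 0 + (N₂ * m + o) ≡ (N₁ + N₂) * m + o
    shift = solve-∀
    cases : o₁ ≡ 0 ⊎ ∃ (InBlocks 0 K N₁ o₁) → o₂ ≡ 0 ⊎ ∃ (InBlocks 0 K N₂ o₂) →
            T (memS ((N₁ * m + o₁) + (N₂ * m + o₂)))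
    cases (inj₁ refl) _ = subst (T ∘ memS) (sym (shift N₁ N₂ m o₂))
      (atLevel⇒∈ (N₁ + N₂) o₂<m (atLevel-mono o₂ (m≤n+m N₂ N₁) h₂))
    cases (inj₂ _) (inj₁ refl) =
      subst (T ∘ memS) (trans (sym (shift N₂ N₁ m o₁)) (+-comm (N₂ * m + 0) (N₁ * m + o₁)))
      (atLevel⇒∈ (N₂ + N₁) o₁<m (atLevel-mono o₁ (m≤n+m N₁ N₂) h₁))
    cases (inj₂ (t₁ , b₁)) (inj₂ (t₂ , b₂)) with t₁ + t₂ ≤? K
    ... | yes t₁+t₂≤K = blocks-+∈S b₁ b₂ t₁+t₂≤K
    ... | no  K<t₁+t₂ = contradiction (blocks-+-≥c b₁ b₂ (≰⇒> K<t₁+t₂)) (<⇒≱ sum<c)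

  ∈⇒atLevel-/% : ∀ x → x < c → T (memS x) → T (atLevel (x / m) (x % m))
  ∈⇒atLevel-/% x x<c x∈S = ∈⇒atLevel (x / m) (m%n<n x m)
    (subst (_< c) (level-split x) x<c) (subst (T ∘ memS) (level-split x) x∈S)

  memS-closed : ∀ x y → T (memS x) → T (memS y) → T (memS (x + y))
  memS-closed x y x∈S y∈S with c ≤? x + y
  ... | yes c≤x+y = ≥c⇒∈ c≤x+y
  ... | no  x+y≱c = subst (T ∘ memS) (sym split)
    (levels-+ (x / m) (y / m) (m%n<n x m) (m%n<n y m) (subst (_< c) split x+y<c)
      (∈⇒atLevel-/% x (≤-<-trans (m≤m+n x y) x+y<c) x∈S)
      (∈⇒atLevel-/% y (≤-<-trans (m≤n+m y x) x+y<c) y∈S))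
    where
    x+y<c : x + y < c
    x+y<c = ≰⇒> x+y≱c
    split : x + y ≡ (x / m * m + x % m) + (y / m * m + y % m)
    split = cong₂ _+_ (level-split x) (level-split y)

  S : NumericalSemigroup
  S = record { mem = memS ; zero∈ = _ ; closed = memS-closed ; cofinite = c , λ _ → ≥c⇒∈ }

  lastLevel : ℕ
  lastLevel = suc (2 * k)

  2K≡1+lastLevel : 2 * K ≡ suc lastLevel
  2K≡1+lastLevel = 2*[1+n]≡2+2*n k

  c≡1+lastLevel*m : c ≡ suc lastLevel * m
  c≡1+lastLevel*m = cong (_* m) 2K≡1+lastLevel

  lastGap : ℕ
  lastGap = lastLevel * m + suc (K * d)

  c≡1+lastGap : c ≡ suc lastGap
  c≡1+lastGap = trans c≡1+lastLevel*m (trans (+-comm m (lastLevel * m)) (+-suc (lastLevel * m) (suc (K * d))))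

  lastGap∉S : ¬ T (memS lastGap)
  lastGap∉S h = no-offset
    (atLevel⁻ lastLevel o (∈⇒atLevel lastLevel ≤-refl (subst (lastGap <_) (sym c≡1+lastGap) ≤-refl) h))
    where
    o = suc (K * d)
    no-offset : o ≡ 0 ⊎ ∃ (InBlocks 0 K lastLevel o) → ⊥
    no-offset (inj₁ ())
    no-offset (inj₂ (t , blocks 0<t _ _ t∋o)) = <-irrefl refl (InBlock⇒2+o≤m 0<t t∋o)

  isConductor : IsConductor S c
  isConductor = (λ _ → ≥c⇒∈) , least
    where
    least : ∀ d′ → (∀ n → d′ ≤ n → T (memS n)) → c ≤ d′
    least d′ h with c ≤? d′
    ... | yes c≤d′ = c≤d′
    ... | no  c≰d′ = contradiction (h _ (≤-pred (subst (suc d′ ≤_) c≡1+lastGap (≰⇒> c≰d′)))) lastGap∉S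

  m∈S : T (memS m)
  m∈S = subst (T ∘ memS) (trans (+-identityʳ (1 * m)) (*-identityˡ m)) (level∈ 1)

  isMultiplicity : IsMultiplicity S m
  isMultiplicity = z<s , m∈S , least
    where
    least : ∀ x → 0 < x → T (memS x) → m ≤ x
    least x 0<x x∈S = ≮⇒≥ λ x<m →
      not-on-level-0 (atLevel⁻ 0 x (∈⇒atLevel 0 x<m (<-≤-trans x<m (m≤n*m m (2 * K))) x∈S))
      where
      not-on-level-0 : x ≡ 0 ⊎ ∃ (InBlocks 0 K 0 x) → ⊥
      not-on-level-0 (inj₁ refl)                  = <-irrefl refl 0<x
      not-on-level-0 (inj₂ (t , blocks 0<t _ 2t≤1 _)) = <⇒≱ (*-monoʳ-≤ 2 0<t) 2t≤1

  a+d≡m+m : a + d ≡ m + m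
  a+d≡m+m = identity k
    where
    identity : ∀ k → (2 + suc k * (5 + k)) + (2 + k * (5 + k)) + (5 + k)
                   ≡ (2 + suc k * (5 + k)) + (2 + suc k * (5 + k))
    identity = solve-∀

  a+j∈S : ∀ {j} → j ≤ 1 → T (memS (a + j))
  a+j∈S {j} j≤1 = subst (T ∘ memS) (level₁ k j)
    (block∈ 1 (2 + k * d + j) 1 (blocks z<s (s≤s z≤n) (s≤s (s≤s z≤n)) (block j j≤1 (offset k j))))
    where
    level₁ : ∀ k j → 1 * (2 + suc k * (5 + k)) + (2 + k * (5 + k) + j)
                   ≡ (2 + suc k * (5 + k)) + (2 + k * (5 + k)) + j
    level₁ = solve-∀
    offset : ∀ k j → 2 + k * (5 + k) + j + 1 * (5 + k) ≡ (2 + suc k * (5 + k)) + j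
    offset = solve-∀

  a∈S : T (memS a)
  a∈S = subst (T ∘ memS) (+-identityʳ a) (a+j∈S z≤n)

  1+a∈S : T (memS (suc a))
  1+a∈S = subst (T ∘ memS) (+-comm a 1) (a+j∈S ≤-refl)

  a-shift : ∀ N o → suc (suc N) * m + o ≡ a + (N * m + (o + d))
  a-shift N o = sym (begin
    a + (N * m + (o + d))  ≡⟨ rearrange a d (N * m) o ⟩
    (a + d) + (N * m + o)  ≡⟨ cong (_+ (N * m + o)) a+d≡m+m ⟩
    (m + m) + (N * m + o)  ≡⟨ collect m N o ⟩
    suc (suc N) * m + o    ∎)
    where
    open ≡-Reasoning
    rearrange : ∀ a d X o → a + (X + (o + d)) ≡ (a + d) + (X + o)
    rearrange = solve-∀
    collect : ∀ m N o → (m + m) + (N * m + o) ≡ suc (suc N) * m + o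
    collect = solve-∀

  level-decomposable : ∀ N → Decomposition S (suc (suc N) * m + 0)
  level-decomposable N = decomposition m (suc N * m + 0) z<s z<s (+-assoc m (suc N * m) 0) m∈S (level∈ (suc N))

  raise-decomposable : ∀ {N o t} → InBlocks 0 K N o t → Decomposition S (suc N * m + o)
  raise-decomposable {N} {o} {t} b = decomposition m (N * m + o) z<s
    (≤-trans (InBlock⇒>0 (InBlocks.t≤s+n b) (InBlocks.∈block b)) (m≤n+m o (N * m)))
    (+-assoc m (N * m) o) m∈S (block∈ N o t b)

  -- the summand besides a or a + 1 lies in block t + 1, two levels down
  first-level-decomposable : ∀ {t o} → suc (suc t) ≤ K → InBlock (suc (suc t)) o →
                             Decomposition S (suc (suc (suc (2 * t))) * m + o)
  first-level-decomposable {t} {o} t+2≤K (block j j≤t+2 eq) = split (m≤n⇒m<n∨m≡n j≤t+2)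
    where
    L = suc (2 * t)
    L-has-block : 2 * suc t ≤ suc L
    L-has-block = ≤-reflexive (2*[1+n]≡2+2*n t)
    down : ∀ {o′ j′} → j′ ≤ suc t → o′ + suc t * d ≡ m + j′ → T (memS (L * m + o′))
    down j′≤ eq′ = block∈ L _ (suc t) (blocks z<s (≤-trans (n≤1+n _) t+2≤K) L-has-block (block _ j′≤ eq′))
    shift : (o + d) + suc t * d ≡ o + suc (suc t) * d
    shift = regroup o d t
      where
      regroup : ∀ o d t → (o + d) + suc t * d ≡ o + suc (suc t) * d
      regroup = solve-∀
    x≡a+ : suc (suc L) * m + o ≡ a + (L * m + (o + d))
    x≡a+ = a-shift L o
    split : j < suc (suc t) ⊎ j ≡ suc (suc t) → Decomposition S (suc (suc L) * m + o)
    split (inj₁ j<t+2) = decomposition a (L * m + (o + d)) z<s z<s x≡a+ a∈S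
      (down (≤-pred j<t+2) (trans shift eq))
    split (inj₂ refl) = decomposition (suc a) (L * m + (o + (4 + k))) z<s z<s
      (trans x≡a+ (trans (cong (λ z → a + (L * m + z)) (+-suc o (4 + k)))
                         (trans (cong (a +_) (+-suc (L * m) _)) (+-suc a _))))
      1+a∈S
      (down ≤-refl (suc-injective (begin
        suc (o + (4 + k) + suc t * d)  ≡⟨ cong (_+ suc t * d) (+-suc o (4 + k)) ⟨
        (o + d) + suc t * d            ≡⟨ trans shift eq ⟩
        m + suc (suc t)                ≡⟨ +-suc m (suc t) ⟩
        suc (m + suc t)                ∎)))
      where open ≡-Reasoning

  level₁-block₁ : ∀ {o} (b : InBlock 1 o) → m + o ≡ a + InBlock.pos b
  level₁-block₁ {o} (block j _ eq) = +-cancelʳ-≡ d _ _ (begin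
    m + o + d      ≡⟨ +-assoc m o d ⟩
    m + (o + d)    ≡⟨ cong (m +_) (trans (cong (o +_) (sym (*-identityˡ d))) eq) ⟩
    m + (m + j)    ≡⟨ +-assoc m m j ⟨
    m + m + j      ≡⟨ cong (_+ j) a+d≡m+m ⟨
    a + d + j      ≡⟨ xy∙z≈xz∙y a d j ⟩
    a + j + d      ∎)
    where open ≡-Reasoning

  minGen-below-c : ∀ {x} → x < c → T (isMinGen S x) → x ≡ m ⊎ x ≡ a ⊎ x ≡ suc a
  minGen-below-c {x} x<c gen =
    on-level (x / m) (x % m) (level-split x) (atLevel⁻ _ _ (∈⇒atLevel-/% x x<c (isMinGen⇒∈ S {x} gen)))
    where
    Goal = x ≡ m ⊎ x ≡ a ⊎ x ≡ suc a

    indecomposable : ∀ {y} → x ≡ y → Decomposition S y → Goal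
    indecomposable refl D = ⊥-elim (Decomposition⇒¬isMinGen S D gen)

    first-level : ∀ N o t → x ≡ N * m + o → InBlocks 0 K N o t → 2 * t ≡ suc N → Goal
    first-level 1 o 1 eq (blocks _ _ _ (block 0 _ eq′)) _ =
      inj₂ (inj₁ (trans eq (trans (cong (_+ o) (*-identityˡ m))
                                  (trans (level₁-block₁ (block 0 z≤n eq′)) (+-identityʳ a)))))
    first-level 1 o 1 eq (blocks _ _ _ (block 1 _ eq′)) _ =
      inj₂ (inj₂ (trans eq (trans (cong (_+ o) (*-identityˡ m))
                                  (trans (level₁-block₁ (block 1 ≤-refl eq′)) (+-comm a 1)))))
    first-level 1 o 1 eq (blocks _ _ _ (block (suc (suc _)) (s≤s ()) _)) _
    first-level 0             _ 1 _ _ ()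
    first-level (suc (suc _)) _ 1 _ _ ()
    first-level N o (suc (suc t)) eq (blocks _ t≤K _ t∋o) 2t≡1+N =
      indecomposable (trans eq (cong (λ N → N * m + o) N≡)) (first-level-decomposable t≤K t∋o)
      where
      N≡ : N ≡ suc (suc (suc (2 * t)))
      N≡ = suc-injective (trans (sym 2t≡1+N) (trans (2*[1+n]≡2+2*n (suc t)) (cong (suc ∘ suc) (2*[1+n]≡2+2*n t))))

    in-block : ∀ N o t → x ≡ N * m + o → InBlocks 0 K N o t → Dec (2 * t ≤ N) → Goal
    in-block zero    o t eq (blocks 0<t _ _ _) (yes 2t≤0) = ⊥-elim (<⇒≱ (*-monoʳ-≤ 2 0<t) (≤-trans 2t≤0 z≤n))
    in-block (suc N) o t eq (blocks 0<t t≤K _ t∋o) (yes 2t≤1+N) =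
      indecomposable eq (raise-decomposable (blocks 0<t t≤K 2t≤1+N t∋o))
    in-block N o t eq b (no 2t≰N) = first-level N o t eq b (≤-antisym (InBlocks.2t≤1+N b) (≰⇒> 2t≰N))

    on-level : ∀ N o → x ≡ N * m + o → o ≡ 0 ⊎ ∃ (InBlocks 0 K N o) → Goal
    on-level zero          _ eq (inj₁ refl) = ⊥-elim (<-irrefl (sym eq) (isMinGen⇒>0 S {x} gen))
    on-level (suc zero)    _ eq (inj₁ refl) = inj₁ (trans eq (trans (+-identityʳ _) (*-identityˡ m)))
    on-level (suc (suc N)) _ eq (inj₁ refl) = indecomposable eq (level-decomposable N)
    on-level N o eq (inj₂ (t , b)) = in-block N o t eq b (2 * t ≤? N)

  #inBlock : ∀ {t} → 1 ≤ t → t ≤ K → count (inBlock t) m ≡ suc t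
  #inBlock {t} 1≤t t≤K = count-window m (t * d) t m (≤-trans (m≤m+n (t * d) 2) (t*d+2≤m t≤K))
                                      (+-monoʳ-< m (≤-trans (n≤1+n (suc t)) (2+t≤t*d 1≤t)))

  InBlock-disjoint : ∀ {t′ t o} → t′ < t → t ≤ K → InBlock t′ o → InBlock t o → ⊥
  InBlock-disjoint {t′} {t} {o} t′<t t≤K (block j′ _ eq′) (block j j≤t eq) =
    <⇒≱ K<d (+-cancelˡ-≤ m d K (begin
      m + d                ≤⟨ +-monoˡ-≤ d (subst (m ≤_) (sym eq′) (m≤m+n m j′)) ⟩
      (o + t′ * d) + d     ≡⟨ xy∙z≈x∙zy o (t′ * d) d ⟩
      o + suc t′ * d       ≤⟨ +-monoʳ-≤ o (*-monoˡ-≤ d t′<t) ⟩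
      o + t * d            ≡⟨ eq ⟩
      m + j                ≤⟨ +-monoʳ-≤ m (≤-trans j≤t t≤K) ⟩
      m + K                ∎))
    where
    open ≤-Reasoning
    K<d : K < d
    K<d = s≤s (s≤s (m≤n+m k 3))

  blockSizes : (s n N : ℕ) → ℕ
  blockSizes s zero    N = 0
  blockSizes s (suc n) N = blockSizes s n N + (if hasBlock N (s + suc n) then suc (s + suc n) else 0)

  #inBlocks : ∀ s n N → s + n ≤ K → count (inBlocks s n N) m ≡ blockSizes s n N
  #inBlocks s zero    N _       = count-none {λ _ → false} m λ _ _ ()
  #inBlocks s (suc n) N s+n+1≤K = begin
    count (inBlocks s (suc n) N) m
      ≡⟨ count-∨ m disjoint ⟩
    count (inBlocks s n N) m + count (λ o → hasBlock N t ∧ inBlock t o) m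
      ≡⟨ cong₂ _+_ (#inBlocks s n N (≤-trans (+-monoʳ-≤ s (n≤1+n n)) s+n+1≤K))
                   (count-if (hasBlock N t) (inBlock t) m) ⟩
    blockSizes s n N + (if hasBlock N t then count (inBlock t) m else 0)
      ≡⟨ cong (λ z → blockSizes s n N + (if hasBlock N t then z else 0)) (#inBlock 1≤t s+n+1≤K) ⟩
    blockSizes s (suc n) N
      ∎
    where
    open ≡-Reasoning
    t = s + suc n
    1≤t : 1 ≤ t
    1≤t = subst (1 ≤_) (sym (+-suc s n)) (s≤s z≤n)
    disjoint : Below (λ i → T (inBlocks s n N i) → ¬ T (hasBlock N t ∧ inBlock t i)) m
    disjoint i _ old new with inBlocks⁻ s n N i old
    ... | t′ , blocks _ t′≤s+n _ t′∋i =
      InBlock-disjoint (subst (t′ <_) (sym (+-suc s n)) (s≤s t′≤s+n)) s+n+1≤K t′∋i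
                       (inBlock⁻ t i (proj₂ (Equivalence.to (T-∧ {hasBlock N t}) new)))

  #atLevel : ∀ N → count (atLevel N) m ≡ suc (blockSizes 0 K N)
  #atLevel N = trans (count-∨ m disjoint) (cong₂ _+_ (count-≡ᵇ 0 m z<s) (#inBlocks 0 K N ≤-refl))
    where
    disjoint : Below (λ i → T (i ≡ᵇ 0) → ¬ T (inBlocks 0 K N i)) m
    disjoint i _ i≡0 h with inBlocks⁻ 0 K N i h
    ... | t , blocks _ t≤K _ t∋i = <-irrefl (sym (≡ᵇ⇒≡ i 0 i≡0)) (InBlock⇒>0 t≤K t∋i)

  #memS-level : ∀ N → N < 2 * K → count (λ i → memS (N * m + i)) m ≡ suc (blockSizes 0 K N)
  #memS-level N N<2K = trans (count-cong m below-c) (#atLevel N)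
    where
    below-c : Below (λ i → memS (N * m + i) ≡ atLevel N i) m
    below-c i i<m = trans (memS-level N i<m) (cong (_∨ atLevel N i)
      (Equivalence.to T-not-≡ (¬T⇒T-not λ c≤x → <⇒≱ x<c (≤ᵇ⇒≤ c _ c≤x))))
      where
      x<c : N * m + i < c
      x<c = <-≤-trans (+-monoʳ-< (N * m) i<m) (subst (_≤ c) (+-comm m (N * m)) (*-monoˡ-≤ m N<2K))

  #memS-below : ∀ M → M ≤ 2 * K → count memS (M * m) ≡ sumBelow (λ N → suc (blockSizes 0 K N)) M
  #memS-below zero    _      = refl
  #memS-below (suc M) M<2K = begin
    count memS (suc M * m)
      ≡⟨ cong (count memS) (+-comm m (M * m)) ⟩
    count memS (M * m + m)
      ≡⟨ count-+ memS (M * m) m ⟩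
    count memS (M * m) + count (λ i → memS (M * m + i)) m
      ≡⟨ cong₂ _+_ (#memS-below M (<⇒≤ M<2K)) (#memS-level M M<2K) ⟩
    sumBelow (λ N → suc (blockSizes 0 K N)) (suc M)
      ∎
    where open ≡-Reasoning

  decomposableOffset : ℕ → Bool
  decomposableOffset o = ((o ≡ᵇ 0) ∨ inBlocks 1 k lastLevel o) ∨ (m ≤ᵇ o + d)

  a+lastLevel-decomposable : ∀ {r} → r < d → Decomposition S (a + (lastLevel * m + r))
  a+lastLevel-decomposable {0}             _   = decomposition a (lastLevel * m + 0) z<s z<s refl a∈S (level∈ lastLevel)
  a+lastLevel-decomposable {1}             _   = decomposition (suc a) (lastLevel * m + 0) z<s z<s
    (trans (cong (a +_) (+-suc (lastLevel * m) 0)) (+-suc a _)) 1+a∈S (level∈ lastLevel)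
  a+lastLevel-decomposable {suc (suc r)} r<d = in-range (r ≤? K)
    where
    in-last-block : ∀ {r} → r ≤ K → T (memS (lastLevel * m + suc (suc r)))
    in-last-block {r} r≤K = block∈ lastLevel (suc (suc r)) K
      (blocks z<s ≤-refl (≤-reflexive 2K≡1+lastLevel) (block r r≤K (cong (suc ∘ suc) (+-comm r (K * d)))))
    in-range : Dec (r ≤ K) → Decomposition S (a + (lastLevel * m + suc (suc r)))
    in-range (yes r≤K) = decomposition a (lastLevel * m + suc (suc r)) z<s z<s refl a∈S (in-last-block r≤K)
    in-range (no  r≰K) = subst (λ r → Decomposition S (a + (lastLevel * m + suc (suc r)))) (sym r≡1+K)
      (decomposition (suc a) (lastLevel * m + suc (suc K)) z<s z<s
        (trans (cong (a +_) (+-suc (lastLevel * m) (suc (suc K)))) (+-suc a _)) 1+a∈S (in-last-block ≤-refl))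
      where
      r≡1+K : r ≡ suc K
      r≡1+K = ≤-antisym (≤-pred (≤-pred (≤-pred r<d))) (≰⇒> r≰K)

  decomposable-above-c : ∀ o → o < m → T (decomposableOffset o) → Decomposition S (c + o)
  decomposable-above-c o o<m h = [ low , high ]′ (Equivalence.to (T-∨ {(o ≡ᵇ 0) ∨ inBlocks 1 k lastLevel o}) h)
    where
    c+o≡ : c + o ≡ suc lastLevel * m + o
    c+o≡ = cong (_+ o) c≡1+lastLevel*m
    low : T ((o ≡ᵇ 0) ∨ inBlocks 1 k lastLevel o) → Decomposition S (c + o)
    low h′ = [ zero-offset , in-block ]′ (Equivalence.to (T-∨ {o ≡ᵇ 0}) h′)
      where
      zero-offset : T (o ≡ᵇ 0) → Decomposition S (c + o)
      zero-offset o≡0 = Decomposition-cong (trans c+o≡ (cong (suc lastLevel * m +_) (≡ᵇ⇒≡ o 0 o≡0)))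
                                           (level-decomposable (2 * k))
      in-block : T (inBlocks 1 k lastLevel o) → Decomposition S (c + o)
      in-block h″ with inBlocks⁻ 1 k lastLevel o h″
      ... | t , blocks 1<t t≤K 2t≤1+lastLevel t∋o =
        Decomposition-cong c+o≡ (raise-decomposable (blocks (<-trans z<s 1<t) t≤K 2t≤1+lastLevel t∋o))
    high : T (m ≤ᵇ o + d) → Decomposition S (c + o)
    high m≤o+d with m≤n⇒∃[o]m+o≡n (≤ᵇ⇒≤ m _ m≤o+d)
    ... | r , m+r≡o+d = Decomposition-cong c+o≡a+ (a+lastLevel-decomposable r<d)
      where
      r<d : r < d
      r<d = +-cancelˡ-< m r d (subst (_< m + d) (sym m+r≡o+d) (+-monoˡ-< d o<m))
      c+o≡a+ : c + o ≡ a + (lastLevel * m + r)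
      c+o≡a+ = begin
        c + o                          ≡⟨ c+o≡ ⟩
        suc (suc (2 * k)) * m + o      ≡⟨ a-shift (2 * k) o ⟩
        a + (2 * k * m + (o + d))      ≡⟨ cong (λ z → a + (2 * k * m + z)) m+r≡o+d ⟨
        a + (2 * k * m + (m + r))      ≡⟨ cong (a +_) (x∙yz≈yx∙z (2 * k * m) m r) ⟩
        a + (lastLevel * m + r)              ∎
        where open ≡-Reasoning

  InBlock⇒o+d<m : ∀ {t o} → 2 ≤ t → InBlock t o → o + d < m
  InBlock⇒o+d<m {1} (s≤s ()) _
  InBlock⇒o+d<m {suc (suc t)} {o} _ (block j j≤t eq) = ≰⇒> λ m≤o+d →
    <⇒≱ t+2<d+t*d (+-cancelˡ-≤ m _ _ (begin
      m + (d + t * d)          ≤⟨ +-monoˡ-≤ (d + t * d) m≤o+d ⟩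
      (o + d) + (d + t * d)    ≡⟨ +-assoc o d (d + t * d) ⟩
      o + suc (suc t) * d      ≡⟨ eq ⟩
      m + j                    ≤⟨ +-monoʳ-≤ m j≤t ⟩
      m + suc (suc t)          ∎))
    where
    open ≤-Reasoning
    t+2<d+t*d : suc (suc t) < d + t * d
    t+2<d+t*d = +-mono-≤ (s≤s (s≤s (s≤s z≤n))) (m≤m*n t d)

  d≤m : d ≤ m
  d≤m = ≤-trans (m≤m+n d (k * d)) (m≤n+m (K * d) 2)

  #decomposableOffset : count decomposableOffset m ≡ (1 + blockSizes 1 k lastLevel) + d
  #decomposableOffset = begin
    count decomposableOffset m
      ≡⟨ count-∨ m low∩high≡∅ ⟩
    count (λ o → (o ≡ᵇ 0) ∨ inBlocks 1 k lastLevel o) m + count (λ o → m ≤ᵇ o + d) m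
      ≡⟨ cong₂ _+_ (trans (count-∨ m zero∩block≡∅) (cong₂ _+_ (count-≡ᵇ 0 m z<s) (#inBlocks 1 k lastLevel ≤-refl)))
                   #high ⟩
    (1 + blockSizes 1 k lastLevel) + d
      ∎
    where
    open ≡-Reasoning
    zero∩block≡∅ : Below (λ i → T (i ≡ᵇ 0) → ¬ T (inBlocks 1 k lastLevel i)) m
    zero∩block≡∅ i _ i≡0 h with inBlocks⁻ 1 k lastLevel i h
    ... | t , blocks _ t≤K _ t∋i = <-irrefl (sym (≡ᵇ⇒≡ i 0 i≡0)) (InBlock⇒>0 t≤K t∋i)
    low∩high≡∅ : Below (λ i → T ((i ≡ᵇ 0) ∨ inBlocks 1 k lastLevel i) → ¬ T (m ≤ᵇ i + d)) m
    low∩high≡∅ i _ h m≤i+d with Equivalence.to (T-∨ {i ≡ᵇ 0}) h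
    ... | inj₁ i≡0 = <⇒≱ (subst (λ i → i + d < m) (sym (≡ᵇ⇒≡ i 0 i≡0)) d<m) (≤ᵇ⇒≤ m _ m≤i+d)
      where
      d<m : d < m
      d<m = ≤-trans (s≤s (m≤m+n d (k * d))) (m≤n+m (suc (K * d)) 1)
    ... | inj₂ h′ with inBlocks⁻ 1 k lastLevel i h′
    ...   | t , blocks 1<t _ _ t∋i = <⇒≱ (InBlock⇒o+d<m 1<t t∋i) (≤ᵇ⇒≤ m _ m≤i+d)
    #high : count (λ o → m ≤ᵇ o + d) m ≡ d
    #high = count-interval (m ∸ d) d m (≤-reflexive (m∸n+n≡m d≤m))
      (λ i i<m m≤i+d → +-cancelʳ-≤ d _ i (subst (_≤ i + d) (sym (m∸n+n≡m d≤m)) (≤ᵇ⇒≤ m _ m≤i+d))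
                     , subst (i <_) (sym (m∸n+n≡m d≤m)) i<m)
      (λ i l≤i _ → ≤⇒≤ᵇ (subst (_≤ i + d) (m∸n+n≡m d≤m) (+-monoˡ-≤ d l≤i)))

  1+2n≤2K : ∀ {n} → n < K → suc (2 * n) ≤ 2 * K
  1+2n≤2K {n} n<K = ≤-trans (n≤1+n _) (subst (_≤ 2 * K) (2*[1+n]≡2+2*n n) (*-monoʳ-≤ 2 n<K))

  #levels-with-block : ∀ {n} → n < K → count (λ N → hasBlock N (suc n)) (2 * K) ≡ 2 * K ∸ suc (2 * n)
  #levels-with-block {n} n<K = count-interval (suc (2 * n)) (2 * K ∸ suc (2 * n)) (2 * K)
    (≤-reflexive (m+[n∸m]≡n (1+2n≤2K n<K)))
    (λ N N<2K h → ≤-pred (subst (_≤ suc N) (2*[1+n]≡2+2*n n) (≤ᵇ⇒≤ _ _ h))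
                , subst (N <_) (sym (m+[n∸m]≡n (1+2n≤2K n<K))) N<2K)
    (λ N l≤N _ → ≤⇒≤ᵇ (subst (_≤ suc N) (sym (2*[1+n]≡2+2*n n)) (s≤s l≤N)))

  blocksOnAllLevels : ℕ → ℕ
  blocksOnAllLevels n = sumBelow (blockSizes 0 n) (2 * K)

  blocksOnAllLevels-suc : ∀ n → n < K →
    blocksOnAllLevels (suc n) ≡ blocksOnAllLevels n + suc (suc n) * (2 * K ∸ suc (2 * n))
  blocksOnAllLevels-suc n n<K =
    trans (sumBelow-+ (blockSizes 0 n) (λ N → if hasBlock N (suc n) then suc (suc n) else 0) (2 * K))
          (cong (blocksOnAllLevels n +_) (trans (sumBelow-if (λ N → hasBlock N (suc n)) (suc (suc n)) (2 * K))
                                               (cong (suc (suc n) *_) (#levels-with-block n<K))))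

  blocksOnAllLevels-closed : ∀ n → n ≤ K →
    6 * blocksOnAllLevels n + 4 * (n * n * n) + 9 * (n * n) ≡ 3 * n * (n + 3) * (2 * K) + n
  blocksOnAllLevels-closed zero    _   = cong (λ z → 6 * z + 0 + 0) (sumBelow-0 (2 * K))
  blocksOnAllLevels-closed (suc n) n<K = begin
    6 * blocksOnAllLevels (suc n) + 4 * (suc n * suc n * suc n) + 9 * (suc n * suc n)
      ≡⟨ cong (λ z → 6 * z + 4 * (suc n * suc n * suc n) + 9 * (suc n * suc n)) (blocksOnAllLevels-suc n n<K) ⟩
    6 * (blocksOnAllLevels n + suc (suc n) * w) + 4 * (suc n * suc n * suc n) + 9 * (suc n * suc n)
      ≡⟨ block-sum-step (blocksOnAllLevels n) w n (trans (blocksOnAllLevels-closed n (<⇒≤ n<K))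
                                                       (cong (λ z → 3 * n * (n + 3) * z + n) (sym w+l≡2K))) ⟩
    3 * suc n * (suc n + 3) * (w + suc (2 * n)) + suc n
      ≡⟨ cong (λ z → 3 * suc n * (suc n + 3) * z + suc n) w+l≡2K ⟩
    3 * suc n * (suc n + 3) * (2 * K) + suc n
      ∎
    where
    open ≡-Reasoning
    w = 2 * K ∸ suc (2 * n)
    w+l≡2K : w + suc (2 * n) ≡ 2 * K
    w+l≡2K = m∸n+n≡m (1+2n≤2K n<K)

  #L : count memS c ≡ 2 * K + blocksOnAllLevels K
  #L = trans (#memS-below (2 * K) ≤-refl) (sumBelow-suc (blockSizes 0 K) (2 * K))

  2*blockSizes-lastLevel : ∀ n → n ≤ k → 2 * blockSizes 1 n lastLevel ≡ n * (n + 5)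
  2*blockSizes-lastLevel zero    _   = refl
  2*blockSizes-lastLevel (suc n) n<k = begin
    2 * (blockSizes 1 n lastLevel + (if hasBlock lastLevel (2 + n) then 3 + n else 0))
      ≡⟨ cong (λ z → 2 * (blockSizes 1 n lastLevel + z)) (if-cong (Equivalence.to T-≡ present)) ⟩
    2 * (blockSizes 1 n lastLevel + (3 + n))
      ≡⟨ *-distribˡ-+ 2 (blockSizes 1 n lastLevel) (3 + n) ⟩
    2 * blockSizes 1 n lastLevel + 2 * (3 + n)
      ≡⟨ cong (_+ 2 * (3 + n)) (2*blockSizes-lastLevel n (<⇒≤ n<k)) ⟩
    n * (n + 5) + 2 * (3 + n)
      ≡⟨ next n ⟩
    suc n * (suc n + 5)
      ∎
    where
    open ≡-Reasoning
    present : T (hasBlock lastLevel (2 + n))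
    present = ≤⇒≤ᵇ (subst (2 * (2 + n) ≤_) 2K≡1+lastLevel (*-monoʳ-≤ 2 (s≤s n<k)))
    next : ∀ n → n * (n + 5) + 2 * (3 + n) ≡ suc n * (suc n + 5)
    next = solve-∀

  #minGen≤3 : count (isMinGen S) c ≤ 3
  #minGen≤3 = begin
    count (isMinGen S) c
      ≤⟨ count-mono {r = candidate} c (λ x x<c gen → candidate⁺ (minGen-below-c x<c gen)) ⟩
    count candidate c
      ≤⟨ count-∨-≤ {_≡ᵇ m} c ⟩
    count (_≡ᵇ m) c + count (λ x → (x ≡ᵇ a) ∨ (x ≡ᵇ suc a)) c
      ≤⟨ +-mono-≤ (count-≡ᵇ-≤ m c)
                  (≤-trans (count-∨-≤ {_≡ᵇ a} {_≡ᵇ suc a} c) (+-mono-≤ (count-≡ᵇ-≤ a c) (count-≡ᵇ-≤ (suc a) c))) ⟩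
    3 ∎
    where
    open ≤-Reasoning
    candidate : ℕ → Bool
    candidate x = (x ≡ᵇ m) ∨ ((x ≡ᵇ a) ∨ (x ≡ᵇ suc a))
    candidate⁺ : ∀ {x} → x ≡ m ⊎ x ≡ a ⊎ x ≡ suc a → T (candidate x)
    candidate⁺ {x} = Equivalence.from (T-∨ {x ≡ᵇ m}) ∘ ⊎-map (≡⇒≡ᵇ x m)
      (Equivalence.from (T-∨ {x ≡ᵇ a}) ∘ ⊎-map (≡⇒≡ᵇ x a) (≡⇒≡ᵇ x (suc a)))

  ceilDiv[c,m]≡2K : ceilDiv c m ≡ 2 * K
  ceilDiv[c,m]≡2K = /-level (2 * K) ≤-refl

  eliahou-gap : count (isMinGen S) c * count memS c + k ≤ ceilDiv c m * count (λ i → not (isMinGen S (c + i))) m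
  eliahou-gap = subst (λ q → PL * Ls + k ≤ q * Dq) (sym ceilDiv[c,m]≡2K) (*-cancelˡ-≤ 2 (begin
    2 * (PL * Ls + k)                     ≤⟨ *-monoʳ-≤ 2 (+-monoˡ-≤ k (*-monoˡ-≤ Ls #minGen≤3)) ⟩
    2 * (3 * Ls + k)                      ≡⟨ distribute Ls k ⟩
    6 * Ls + 2 * k                        ≤⟨ +-monoʳ-≤ (6 * Ls) (2*n≤[1+n]*n k) ⟩
    6 * Ls + K * k                        ≡⟨ cong (λ z → 6 * z + K * k) #L ⟩
    6 * (2 * K + blocksOnAllLevels K) + K * k
                                          ≡⟨ eliahou-identity k (blocksOnAllLevels K) (blockSizes 1 k lastLevel)
                                               (blocksOnAllLevels-closed K ≤-refl) (2*blockSizes-lastLevel k ≤-refl) ⟩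
    4 * K * ((1 + blockSizes 1 k lastLevel) + d) ≡⟨ cong (4 * K *_) #decomposableOffset ⟨
    4 * K * count decomposableOffset m    ≤⟨ *-monoʳ-≤ (4 * K) (count-mono m λ o o<m h →
                                               ¬T⇒T-not (Decomposition⇒¬isMinGen S (decomposable-above-c o o<m h))) ⟩
    4 * K * Dq                            ≡⟨ regroup K Dq ⟩
    2 * (2 * K * Dq)                      ∎))
    where
    open ≤-Reasoning
    PL = count (isMinGen S) c
    Ls = count memS c
    Dq = count (λ i → not (isMinGen S (c + i))) m
    distribute : ∀ x k → 2 * (3 * x + k) ≡ 6 * x + 2 * k
    distribute = solve-∀
    regroup : ∀ K x → 4 * K * x ≡ 2 * (2 * K * x)
    regroup = solve-∀

  eliahou≤-k : Eliahou S c m ℤ.≤ ℤ.- ℤ.+ k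
  eliahou≤-k = begin
    Eliahou S c m                                   ≡⟨ cong (λ ρ → A−B ℤ.+ ℤ.+ ρ) ρ≡0 ⟩
    A−B ℤ.+ ℤ.+ 0                                   ≡⟨ ℤ.+-identityʳ A−B ⟩
    A−B                                             ≤⟨ +m-+n≤-+o _ _ k eliahou-gap ⟩
    ℤ.- ℤ.+ k                                       ∎
    where
    open ℤ.≤-Reasoning
    A−B = ℤ.+ (count (isMinGen S) c * count memS c)
          ℤ.- ℤ.+ (ceilDiv c m * count (λ i → not (isMinGen S (c + i))) m)
    ρ≡0 : ceilDiv c m * m ∸ c ≡ 0
    ρ≡0 = trans (cong (λ q → q * m ∸ c) ceilDiv[c,m]≡2K) (n∸n≡0 c)

corollary3p21 : (N : ℤ) →
    ∃ λ (S : NumericalSemigroup) → ∃ λ c → ∃ λ m →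
      IsConductor S c × IsMultiplicity S m × Eliahou S c m ℤ.< N
corollary3p21 N = S , c , m , isConductor , isMultiplicity , ℤ.≤-<-trans eliahou≤-k (-1-∣i∣<i N)
  where open Construction (suc ℤ.∣ N ∣)
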